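{- Let $G$ be a multigraph, $k$ an integer, and $\Delta$ the maximum degree of $G$. Suppose that none of the following holds: (R1a) some edge has multiplicity at least three; (R1b) some vertex has degree at most one; (R1c) there are two vertices $u,v$ with at least $k+2$ common neighbours such that the multiplicity of $uv$ is less than two; (R1d) some vertex is incident to a loop or to double-edges with at least $k+1$ distinct vertices; (R2) there are vertices $a,x,b$ forming an induced path $a-x-b$ (so $ab\notin E(G)$) with $N(x)=\{a,b\}$; (R3) there are pairwise adjacent vertices $u,x,y$ with $N[x]=N[y]=\{u,x,y\}$; (R4) some vertex $u$ is joined by a double-edge to some vertex of degree two; (R5) there are vertices $a,b$ and a set $\varepsilon$ of degree-two vertices with $N(z)=\{a,b\}$ for every $z\in\varepsilon$ and $N(b)=\{a\}\cup\varepsilon$. Then $\mathrm{fvs}(G)\ge |V(G)|/(3\Delta-3)$.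
   Context: Multigraphs may have parallel edges and loops. The degree $\deg(v)$ of a vertex is the number of edges incident to it (counted with multiplicity); $N(v)$ is the set of distinct neighbours of $v$ and $N[v]=N(v)\cup\{v\}$. The multiplicity of $uv$ is the number of edges between $u$ and $v$; $uv$ is a double-edge if its multiplicity is two. A feedback vertex set is a set $X\subseteq V(G)$ such that $G-X$ has no cycle (loops and pairs of parallel edges are cycles), and $\mathrm{fvs}(G)$ is the minimum size of a feedback vertex set of $G$. -}

module Defs where

open import Data.Nat using (ℕ; zero; suc; _+_; _*_; _∸_; _≤_; _<_; _⊔_; _≡ᵇ_; _≤ᵇ_)
open import Data.Integer as ℤ using (ℤ; +_)
open import Data.Fin using (Fin; _≟_)
open import Data.Fin.Subset using (Subset; _∈_; _∉_; ∣_∣)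
open import Data.Vec using (tabulate)
open import Data.Bool using (Bool; _∧_; not)
open import Data.List using (List; []; _∷_; _++_; [_]; map; foldr; allFin)
open import Data.Nat.ListAction using (sum)
open import Data.List.Relation.Unary.All using (All)
open import Data.List.Relation.Unary.Linked using (Linked)
open import Data.List.Relation.Unary.Unique.Propositional using (Unique)
open import Data.Product using (Σ; ∃; _×_; _,_)
open import Data.Sum using (_⊎_)
open import Data.Empty using (⊥)
open import Relation.Nullary using (¬_; ⌊_⌋)
open import Relation.Binary.PropositionalEquality using (_≡_; _≢_)
open import Function.Bundles using (_⇔_)

-- A finite multigraph on vertex set Fin n, given by a symmetric
-- multiplicity function; mult v v is the number of loops at v.
record MultiGraph (n : ℕ) : Set where
  field
    mult : Fin n → Fin n → ℕ
    mult-sym : ∀ u v → mult u v ≡ mult v u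
open MultiGraph public

module _ {n : ℕ} (G : MultiGraph n) where

  -- u and v are adjacent (u ∈ N(v)); a loop makes v ∈ N(v)
  Adj : Fin n → Fin n → Set
  Adj u v = 1 ≤ mult G u v

  adjᵇ : Fin n → Fin n → Bool
  adjᵇ u v = 1 ≤ᵇ mult G u v

  -- degree: number of incident edges counted with multiplicity (a loop counts once)
  deg : Fin n → ℕ
  deg v = sum (map (mult G v) (allFin n))

  -- maximum degree (0 for the empty graph)
  maxDeg : ℕ
  maxDeg = foldr _⊔_ 0 (map deg (allFin n))

  commonNbrs : Fin n → Fin n → Subset n
  commonNbrs u v = tabulate (λ w → adjᵇ u w ∧ adjᵇ v w)

  doubleNbrs : Fin n → Subset n
  doubleNbrs v = tabulate (λ w → not ⌊ w ≟ v ⌋ ∧ (mult G v w ≡ᵇ 2))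

  -- cycles: a loop, a pair of parallel edges, or a cycle on ≥ 3 distinct vertices
  CycleShape : List (Fin n) → Set
  CycleShape [] = ⊥
  CycleShape (v ∷ []) = 1 ≤ mult G v v
  CycleShape (u ∷ v ∷ []) = 2 ≤ mult G u v
  CycleShape (v₀ ∷ v₁ ∷ v₂ ∷ vs) = Linked Adj ((v₀ ∷ v₁ ∷ v₂ ∷ vs) ++ [ v₀ ])

  IsCycle : List (Fin n) → Set
  IsCycle vs = Unique vs × CycleShape vs

  IsFVS : Subset n → Set
  IsFVS X = ¬ (Σ (List (Fin n)) λ vs → IsCycle vs × All (_∉ X) vs)

  R1a : Set
  R1a = ∃ λ u → ∃ λ v → 3 ≤ mult G u v

  R1b : Set
  R1b = ∃ λ v → deg v ≤ 1

  R1c : ℤ → Set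
  R1c k = ∃ λ u → ∃ λ v → u ≢ v
            × (k ℤ.+ + 2) ℤ.≤ + ∣ commonNbrs u v ∣
            × mult G u v < 2

  R1d : ℤ → Set
  R1d k = ∃ λ v → 1 ≤ mult G v v ⊎ (k ℤ.+ + 1) ℤ.≤ + ∣ doubleNbrs v ∣

  R2 : Set
  R2 = ∃ λ a → ∃ λ x → ∃ λ b → a ≢ x × x ≢ b × a ≢ b
         × Adj a x × Adj x b × mult G a b ≡ 0
         × (∀ w → Adj x w ⇔ (w ≡ a ⊎ w ≡ b))

  R3 : Set
  R3 = ∃ λ u → ∃ λ x → ∃ λ y → u ≢ x × u ≢ y × x ≢ y
         × Adj u x × Adj u y × Adj x y
         × (∀ w → (w ≡ x ⊎ Adj x w) ⇔ (w ≡ u ⊎ w ≡ x ⊎ w ≡ y))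
         × (∀ w → (w ≡ y ⊎ Adj y w) ⇔ (w ≡ u ⊎ w ≡ x ⊎ w ≡ y))

  R4 : Set
  R4 = ∃ λ u → ∃ λ v → u ≢ v × mult G u v ≡ 2 × deg v ≡ 2

  R5 : Set
  R5 = ∃ λ a → ∃ λ b → Σ (Subset n) λ ε → a ≢ b
         × (∀ z → z ∈ ε → deg z ≡ 2 × (∀ w → Adj z w ⇔ (w ≡ a ⊎ w ≡ b)))
         × (∀ w → Adj b w ⇔ (w ≡ a ⊎ w ∈ ε))

{-# OPTIONS --safe #-}
module Submission where

-- Put F = V ∖ X. Since G − X is a forest, the edges inside F contribute at most 2|F| to
-- the degree sum of F. Every vertex has degree at least 2, and the reduction rules force a
-- degree-2 vertex v to have two adjacent neighbours a, b, neither of degree 2; if v ∈ F,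
-- the triangle v a b meets X. So let each v ∈ F count its edges into X with weight 2 if
-- deg v = 2 and weight 1 otherwise: together with its edges inside F, every v ∈ F collects
-- at least 3, whence |F| ≤ ∑_{w ∈ X} wdeg w, where wdeg w weighs the edges at w in the
-- same way. Each w has a neighbour of degree other than 2, so wdeg w < 2 deg w ≤ 2Δ, and
-- n ≤ 2Δ|X| ≤ (3Δ − 3)|X| because Δ ≥ 3.

open import Algebra.Properties.CommutativeSemigroup using (x∙yz≈y∙xz)
import Algebra.Properties.Semiring.Sum as SemiringSum
open import Data.Bool using (true; false; if_then_else_; _∨_)
open import Data.Bool.Properties using (∨-comm)
open import Data.Fin using (Fin; zero; suc; _≟_)
open import Data.Fin.Properties using (injective⇒≤; any?)
open import Data.Fin.Subset using (Subset; _∈_; _∉_; ∣_∣; ⁅_⁆; ⊥; ∁)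
open import Data.Fin.Subset.Properties
  using (_∈?_; x∈⁅x⁆; x∈⁅y⁆⇒x≡y; x∉p⇒x∈∁p; x∈∁p⇒x∉p; ∣p∣≤n; ∣∁p∣≡n∸∣p∣)
open import Data.Integer using (ℤ)
open import Data.List as List using (List; []; _∷_; _++_; [_]; allFin)
open import Data.List.Membership.Propositional using (lose) renaming (_∈_ to _∈ₗ_)
open import Data.List.Membership.Propositional.Properties using (∈-map⁺; ∈-allFin; ∈-lookup)
open import Data.List.Properties using (map-tabulate; foldr-preservesᵒ)
open import Data.List.Relation.Binary.Sublist.Propositional using (_⊆_; []; _∷_; _∷ʳ_; minimum)
open import Data.List.Relation.Binary.Sublist.Propositional.Properties using (All-resp-⊆)
open import Data.List.Relation.Unary.All as All using (All; []; _∷_)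
open import Data.List.Relation.Unary.All.Properties using (¬Any⇒All¬)
open import Data.List.Relation.Unary.AllPairs using ([]; _∷_)
open import Data.List.Relation.Unary.Any using (here; there)
open import Data.List.Relation.Unary.Linked as Linked using (Linked; []; [-]; _∷_)
open import Data.List.Relation.Unary.Unique.Propositional using (Unique)
open import Data.Nat using (ℕ; zero; suc; _+_; _*_; _∸_; _⊔_; _≤_; _<_; _≤?_; _<?_; z≤n; s≤s; z<s)
open import Data.Nat.ListAction using (sum)
open import Data.Nat.Properties
  using ( ≤-refl; ≤-reflexive; ≤-trans; ≤-<-trans; ≤-pred; ≰⇒>; ≮⇒≥; <⇒≢; >⇒≢; ≤∧≢⇒<; 1+n≰n; n≤1+n
        ; n≤0⇒n≡0; m≤m+n; m≤n+m; m<m+n; m≤n⇒m≤n⊔o; m≤n⇒m≤o⊔n; m+[n∸m]≡n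
        ; +-assoc; +-comm; +-suc; +-identityʳ; +-mono-≤; +-monoˡ-≤; +-monoʳ-≤; +-mono-<-≤; +-mono-≤-<
        ; +-cancelˡ-≤; +-cancelˡ-<; *-comm; *-identityˡ; *-identityʳ; *-zeroʳ; *-distribˡ-+
        ; *-monoˡ-≤; *-monoʳ-≤; +-commutativeSemigroup; +-*-semiring; module ≤-Reasoning )
  renaming (_≟_ to _≟ℕ_)
open import Data.Nat.Tactic.RingSolver using (solve-∀)
open import Data.Product using (Σ; ∃; _×_; _,_)
open import Data.Sum as Sum using (_⊎_; inj₁; inj₂; [_,_]′)
open import Data.Vec using ([]; _∷_; lookup)
open import Data.Vec.Functional using (Vector; updateAt)
open import Data.Vec.Functional.Properties using (updateAt-updates; updateAt-minimal)
open import Data.Vec.Properties using ([]=⇒lookup; lookup⇒[]=)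
open import Function using (id; const; flip; _∘_; _∘₂_)
open import Function.Bundles using (_⇔_; mk⇔)
open import Relation.Binary.PropositionalEquality
  using (_≡_; _≢_; refl; sym; trans; cong; cong₂; subst; subst₂; module ≡-Reasoning)
open import Relation.Nullary using (¬_; contradiction; yes; no)
open import Relation.Nullary.Decidable using (_×-dec_)

open import Defs

open SemiringSum +-*-semiring using (sum-cong-≗; sum-replicate-zero; ∑-distrib-+; ∑-comm; *-distribˡ-sum)
  renaming (sum to ∑)

private
  variable
    n : ℕ

zeroAt : Fin n → Vector ℕ n → Vector ℕ n
zeroAt i f = updateAt f i (const 0)

∑-zeroAt : ∀ (f : Vector ℕ n) i → ∑ f ≡ f i + ∑ (zeroAt i f)
∑-zeroAt f zero    = refl
∑-zeroAt f (suc i) =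
  trans (cong (f zero +_) (∑-zeroAt (f ∘ suc) i)) (x∙yz≈y∙xz +-commutativeSemigroup (f zero) (f (suc i)) _)

∑-mono-≤ : ∀ {f g : Vector ℕ n} → (∀ i → f i ≤ g i) → ∑ f ≤ ∑ g
∑-mono-≤ {zero}  f≤g = z≤n
∑-mono-≤ {suc n} f≤g = +-mono-≤ (f≤g zero) (∑-mono-≤ (f≤g ∘ suc))

∑-mono-< : ∀ {f g : Vector ℕ n} → (∀ i → f i ≤ g i) → ∀ i → f i < g i → ∑ f < ∑ g
∑-mono-< f≤g zero    fi<gi = +-mono-<-≤ fi<gi (∑-mono-≤ (f≤g ∘ suc))
∑-mono-< f≤g (suc i) fi<gi = +-mono-≤-< (f≤g zero) (∑-mono-< (f≤g ∘ suc) i fi<gi)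

∑-≥-term : ∀ (f : Vector ℕ n) i → f i ≤ ∑ f
∑-≥-term f i = subst (f i ≤_) (sym (∑-zeroAt f i)) (m≤m+n (f i) _)

∑-≥-two-terms : ∀ (f : Vector ℕ n) {i j} → i ≢ j → f i + f j ≤ ∑ f
∑-≥-two-terms f {i} {j} i≢j = begin
  f i + f j             ≡⟨ cong (f i +_) (updateAt-minimal j i f (i≢j ∘ sym)) ⟨
  f i + zeroAt i f j    ≤⟨ +-monoʳ-≤ (f i) (∑-≥-term (zeroAt i f) j) ⟩
  f i + ∑ (zeroAt i f)  ≡⟨ ∑-zeroAt f i ⟨
  ∑ f                   ∎
  where open ≤-Reasoning

∑-≥-three-terms : ∀ (f : Vector ℕ n) {i j k} → i ≢ j → i ≢ k → j ≢ k → f i + (f j + f k) ≤ ∑ f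
∑-≥-three-terms f {i} {j} {k} i≢j i≢k j≢k = begin
  f i + (f j + f k)                    ≡⟨ cong (f i +_) (cong₂ _+_ (updateAt-minimal j i f (i≢j ∘ sym))
                                                                   (updateAt-minimal k i f (i≢k ∘ sym))) ⟨
  f i + (zeroAt i f j + zeroAt i f k)  ≤⟨ +-monoʳ-≤ (f i) (∑-≥-two-terms (zeroAt i f) j≢k) ⟩
  f i + ∑ (zeroAt i f)                 ≡⟨ ∑-zeroAt f i ⟨
  ∑ f                                  ∎
  where open ≤-Reasoning

∑-positive : ∀ (f : Vector ℕ n) → 0 < ∑ f → ∃ λ i → 0 < f i
∑-positive {suc n} f 0<∑ with f zero in f0≡
... | suc _ = zero , subst (0 <_) (sym f0≡) z<s
... | zero  = let i , 0<fi = ∑-positive (f ∘ suc) 0<∑ in suc i , 0<fi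

∑-positive-elsewhere : ∀ (f : Vector ℕ n) i → f i < ∑ f → ∃ λ j → j ≢ i × 0 < f j
∑-positive-elsewhere f i fi<∑f =
  let j , 0<gj = ∑-positive g 0<∑g
      j≢i j≡i = <⇒≢ 0<gj (sym (trans (cong g j≡i) (updateAt-updates i f)))
  in j , j≢i , subst (0 <_) (updateAt-minimal j i f j≢i) 0<gj
  where
  g = zeroAt i f
  0<∑g : 0 < ∑ g
  0<∑g = +-cancelˡ-< (f i) 0 _ (subst₂ _<_ (sym (+-identityʳ (f i))) (∑-zeroAt f i) fi<∑f)

sum-tabulate : ∀ (f : Vector ℕ n) → sum (List.tabulate f) ≡ ∑ f
sum-tabulate {zero}  f = refl
sum-tabulate {suc n} f = cong (f zero +_) (sum-tabulate (f ∘ suc))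

restrict : Subset n → Vector ℕ n → Vector ℕ n
restrict S f v = if lookup S v then f v else 0

∑∈ : Subset n → Vector ℕ n → ℕ
∑∈ S f = ∑ (restrict S f)

infixl 10 ∑∈
syntax ∑∈ S (λ v → e) = ∑[ v ∈ S ] e

lookup-∉ : ∀ {S : Subset n} {v} → v ∉ S → lookup S v ≡ false
lookup-∉ {S = S} {v} v∉S with lookup S v in eq
... | true  = contradiction (lookup⇒[]= v S eq) v∉S
... | false = refl

restrict-∈ : ∀ {S : Subset n} {f v} → v ∈ S → restrict S f v ≡ f v
restrict-∈ {f = f} {v} v∈S = cong (λ b → if b then f v else 0) ([]=⇒lookup v∈S)

∑∈≤∑ : ∀ (S : Subset n) f → ∑∈ S f ≤ ∑ f
∑∈≤∑ S f = ∑-mono-≤ (λ v → if-≤ (lookup S v))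
  where
  if-≤ : ∀ b {m} → (if b then m else 0) ≤ m
  if-≤ true  = ≤-refl
  if-≤ false = z≤n

∑∈-≥-term : ∀ {S : Subset n} f {v} → v ∈ S → f v ≤ ∑∈ S f
∑∈-≥-term {S = S} f {v} v∈S = subst (_≤ ∑∈ S f) (restrict-∈ {f = f} v∈S) (∑-≥-term (restrict S f) v)

∑∈-mono-≤ : ∀ (S : Subset n) {f g} → (∀ v → v ∈ S → f v ≤ g v) → ∑∈ S f ≤ ∑∈ S g
∑∈-mono-≤ S {f} {g} f≤g = ∑-mono-≤ pointwise
  where
  pointwise : ∀ v → restrict S f v ≤ restrict S g v
  pointwise v with lookup S v in eq
  ... | true  = f≤g v (lookup⇒[]= v S eq)
  ... | false = z≤n

∑∈-const : ∀ (S : Subset n) c → ∑[ v ∈ S ] c ≡ ∣ S ∣ * c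
∑∈-const []          c = refl
∑∈-const (true  ∷ S) c = cong (c +_) (∑∈-const S c)
∑∈-const (false ∷ S) c = ∑∈-const S c

∑∈-distrib-+ : ∀ (S : Subset n) f g → ∑[ v ∈ S ] (f v + g v) ≡ ∑∈ S f + ∑∈ S g
∑∈-distrib-+ S f g =
  trans (sum-cong-≗ (λ v → if-+ (lookup S v) (f v) (g v))) (∑-distrib-+ (restrict S f) (restrict S g))
  where
  if-+ : ∀ b x y → (if b then x + y else 0) ≡ (if b then x else 0) + (if b then y else 0)
  if-+ true  _ _ = refl
  if-+ false _ _ = refl

*-distribˡ-∑∈ : ∀ (S : Subset n) c f → c * ∑∈ S f ≡ ∑[ v ∈ S ] (c * f v)
*-distribˡ-∑∈ S c f = trans (*-distribˡ-sum c (restrict S f)) (sum-cong-≗ (λ v → if-* (lookup S v) (f v)))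
  where
  if-* : ∀ b x → c * (if b then x else 0) ≡ (if b then c * x else 0)
  if-* true  _ = refl
  if-* false _ = *-zeroʳ c

∑-∑∈-comm : ∀ {m} (S : Subset n) (f : Fin m → Fin n → ℕ) →
            ∑ (λ v → ∑[ w ∈ S ] f v w) ≡ ∑[ w ∈ S ] ∑ (λ v → f v w)
∑-∑∈-comm {m = m} S f =
  trans (∑-comm (λ v → restrict S (f v))) (sum-cong-≗ (λ w → if-∑ (lookup S w) (λ v → f v w)))
  where
  if-∑ : ∀ b (g : Vector ℕ m) → ∑ (λ v → if b then g v else 0) ≡ (if b then ∑ g else 0)
  if-∑ true  _ = refl
  if-∑ false _ = sum-replicate-zero m

∑∈-⊥ : ∀ (f : Vector ℕ n) → ∑∈ ⊥ f ≡ 0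
∑∈-⊥ {zero}  f = refl
∑∈-⊥ {suc n} f = ∑∈-⊥ (f ∘ suc)

∑∈-⁅⁆ : ∀ (f : Vector ℕ n) u → ∑∈ ⁅ u ⁆ f ≡ f u
∑∈-⁅⁆ f zero    = trans (cong (f zero +_) (∑∈-⊥ (f ∘ suc))) (+-identityʳ (f zero))
∑∈-⁅⁆ f (suc u) = ∑∈-⁅⁆ (f ∘ suc) u

module _ {A : Set} where

  -- x ∷ truncate xs p is the prefix of x ∷ xs that ends at the position p points to.
  truncate : ∀ {u x : A} xs → u ∈ₗ x ∷ xs → List A
  truncate xs       (here _)  = []
  truncate (y ∷ ys) (there p) = y ∷ truncate ys p

  truncate-⊆ : ∀ {u x : A} xs (p : u ∈ₗ x ∷ xs) → truncate xs p ⊆ xs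
  truncate-⊆ xs       (here _)  = minimum xs
  truncate-⊆ (y ∷ ys) (there p) = refl ∷ truncate-⊆ ys p

  Linked-truncate : ∀ {R : A → A → Set} {u x z : A} xs (p : u ∈ₗ x ∷ xs) →
                    Linked R (x ∷ xs) → R u z → Linked R (x ∷ truncate xs p ++ [ z ])
  Linked-truncate xs       (here refl) _       u~z = u~z ∷ [-]
  Linked-truncate (y ∷ ys) (there p)   (r ∷ L) u~z = r ∷ Linked-truncate ys p L u~z

  Linked⇒All-∃ : ∀ {R : A → A → Set} xs {y} → Linked R (xs ++ [ y ]) → All (λ x → ∃ (R x)) xs
  Linked⇒All-∃ []            _       = []
  Linked⇒All-∃ (x ∷ [])      (r ∷ _) = (_ , r) ∷ []
  Linked⇒All-∃ (x ∷ x′ ∷ xs) (r ∷ L) = (_ , r) ∷ Linked⇒All-∃ (x′ ∷ xs) L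

  Unique-resp-⊆ : ∀ {xs ys : List A} → ys ⊆ xs → Unique xs → Unique ys
  Unique-resp-⊆ []           []       = []
  Unique-resp-⊆ (_ ∷ʳ ys⊆)   (_ ∷ U)  = Unique-resp-⊆ ys⊆ U
  Unique-resp-⊆ (refl ∷ ys⊆) (x∉ ∷ U) = All-resp-⊆ ys⊆ x∉ ∷ Unique-resp-⊆ ys⊆ U

  lookup-injective : ∀ {xs : List A} → Unique xs → ∀ i j → List.lookup xs i ≡ List.lookup xs j → i ≡ j
  lookup-injective (x∉ ∷ U) zero    zero    _ = refl
  lookup-injective (x∉ ∷ U) zero    (suc j) e = contradiction e (All.lookup x∉ (∈-lookup j))
  lookup-injective (x∉ ∷ U) (suc i) zero    e = contradiction (sym e) (All.lookup x∉ (∈-lookup i))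
  lookup-injective (x∉ ∷ U) (suc i) (suc j) e = cong suc (lookup-injective U i j e)

length-unique : ∀ {vs : List (Fin n)} → Unique vs → List.length vs ≤ n
length-unique U = injective⇒≤ (lookup-injective U _ _)

-- Degrees, cycles and vertex deletion

module _ (G : MultiGraph n) where

  deg≡∑ : ∀ v → deg G v ≡ ∑ (mult G v)
  deg≡∑ v = trans (cong sum (map-tabulate id (mult G v))) (sum-tabulate (mult G v))

  mult≤deg : ∀ v w → mult G v w ≤ deg G v
  mult≤deg v w = subst (mult G v w ≤_) (sym (deg≡∑ v)) (∑-≥-term (mult G v) w)

  deg≤maxDeg : ∀ v → deg G v ≤ maxDeg G
  deg≤maxDeg v = foldr-preservesᵒ ≤-⊔ 0 (List.map (deg G) (allFin n)) (inj₂ (lose v∈ ≤-refl))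
    where
    v∈ : deg G v ∈ₗ List.map (deg G) (allFin n)
    v∈ = ∈-map⁺ (deg G) (∈-allFin v)
    ≤-⊔ : ∀ x y → deg G v ≤ x ⊎ deg G v ≤ y → deg G v ≤ x ⊔ y
    ≤-⊔ x y = [ m≤n⇒m≤n⊔o y , m≤n⇒m≤o⊔n x ]′

  Adj-sym : ∀ {u v} → Adj G u v → Adj G v u
  Adj-sym {u} {v} = subst (1 ≤_) (mult-sym G u v)

  ∃-neighbour : ∀ v → 0 < deg G v → ∃ λ w → Adj G v w
  ∃-neighbour v 0<deg = ∑-positive (mult G v) (subst (0 <_) (deg≡∑ v) 0<deg)

  cycle⇒All-∃-neighbour : ∀ {vs} → CycleShape G vs → All (λ v → ∃ (Adj G v)) vs
  cycle⇒All-∃-neighbour {v ∷ []}             loop = (v , loop) ∷ []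
  cycle⇒All-∃-neighbour {u ∷ v ∷ []}         2≤   = (v , u~v) ∷ (u , Adj-sym u~v) ∷ []
    where u~v = ≤-trans (s≤s z≤n) 2≤
  cycle⇒All-∃-neighbour {vs@(_ ∷ _ ∷ _ ∷ _)} L    = Linked⇒All-∃ vs L

Acyclic : MultiGraph n → Set
Acyclic {n} H = ¬ Σ (List (Fin n)) (IsCycle H)

cycle-mono : ∀ {H H′ : MultiGraph n} → (∀ a b → mult H a b ≤ mult H′ a b) →
             ∀ {vs} → IsCycle H vs → IsCycle H′ vs
cycle-mono H≤H′ {v ∷ []}        (U , loop) = U , ≤-trans loop (H≤H′ v v)
cycle-mono H≤H′ {u ∷ v ∷ []}    (U , 2≤)   = U , ≤-trans 2≤ (H≤H′ u v)
cycle-mono H≤H′ {_ ∷ _ ∷ _ ∷ _} (U , L)    = U , Linked.map (λ {a} {b} → flip ≤-trans (H≤H′ a b)) L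

infixl 6 _─_

_─_ : MultiGraph n → Subset n → MultiGraph n
G ─ X = record
  { mult     = λ a b → if lookup X a ∨ lookup X b then 0 else mult G a b
  ; mult-sym = λ a b → cong₂ (λ deleted m → if deleted then 0 else m)
                             (∨-comm (lookup X a) (lookup X b)) (mult-sym G a b)
  }

module _ (G : MultiGraph n) (X : Subset n) where

  ─-≤ : ∀ a b → mult (G ─ X) a b ≤ mult G a b
  ─-≤ a b with lookup X a ∨ lookup X b
  ... | true  = z≤n
  ... | false = ≤-refl

  ─-∈ : ∀ {a} b → a ∈ X → mult (G ─ X) a b ≡ 0
  ─-∈ b a∈X rewrite []=⇒lookup a∈X = refl

  Adj-─⇒∉ : ∀ {a b} → Adj (G ─ X) a b → a ∉ X
  Adj-─⇒∉ {b = b} a~b a∈X = contradiction (subst (1 ≤_) (─-∈ b a∈X) a~b) λ ()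

  deg-─-≤ : ∀ v → deg (G ─ X) v ≤ deg G v
  deg-─-≤ v = subst₂ _≤_ (sym (deg≡∑ (G ─ X) v)) (sym (deg≡∑ G v)) (∑-mono-≤ (─-≤ v))

  deg-─-∈ : ∀ {v} → v ∈ X → deg (G ─ X) v ≡ 0
  deg-─-∈ {v} v∈X = trans (deg≡∑ (G ─ X) v) (trans (sum-cong-≗ (λ w → ─-∈ w v∈X)) (sum-replicate-zero n))

  mult-─-split : ∀ {v} → v ∉ X → ∀ w → mult G v w ≡ mult (G ─ X) v w + restrict X (mult G v) w
  mult-─-split {v} v∉X w = split (lookup X v) (lookup X w) (mult G v w) (lookup-∉ v∉X)
    where
    split : ∀ a b m → a ≡ false → m ≡ (if a ∨ b then 0 else m) + (if b then m else 0)
    split false true  m _ = refl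
    split false false m _ = sym (+-identityʳ m)

  deg-─ : ∀ {v} → v ∉ X → deg G v ≡ deg (G ─ X) v + ∑[ w ∈ X ] mult G v w
  deg-─ {v} v∉X = begin
    deg G v                                               ≡⟨ deg≡∑ G v ⟩
    ∑ (mult G v)                                          ≡⟨ sum-cong-≗ (mult-─-split v∉X) ⟩
    ∑ (λ w → mult (G ─ X) v w + restrict X (mult G v) w)
      ≡⟨ ∑-distrib-+ (mult (G ─ X) v) (restrict X (mult G v)) ⟩
    ∑ (mult (G ─ X) v) + ∑[ w ∈ X ] mult G v w
      ≡⟨ cong (_+ ∑[ w ∈ X ] mult G v w) (deg≡∑ (G ─ X) v) ⟨
    deg (G ─ X) v + ∑[ w ∈ X ] mult G v w                 ∎
    where open ≡-Reasoning

  IsFVS⇒Acyclic : IsFVS G X → Acyclic (G ─ X)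
  IsFVS⇒Acyclic fvs (vs , U , shape) =
    fvs ( vs
        , cycle-mono ─-≤ (U , shape)
        , All.map (λ (_ , v~w) → Adj-─⇒∉ v~w) (cycle⇒All-∃-neighbour (G ─ X) shape))

∑deg-─⁅⁆ : ∀ (H : MultiGraph n) u → ∑ (deg H) ≤ 2 * deg H u + ∑ (deg (H ─ ⁅ u ⁆))
∑deg-─⁅⁆ H u = begin
  ∑ (deg H)                                  ≡⟨ ∑-zeroAt (deg H) u ⟩
  deg H u + ∑ (zeroAt u (deg H))             ≤⟨ +-monoʳ-≤ (deg H u) (∑-mono-≤ pointwise) ⟩
  deg H u + ∑ (λ a → mult H u a + deg H′ a)  ≡⟨ cong (deg H u +_) (∑-distrib-+ (mult H u) (deg H′)) ⟩
  deg H u + (∑ (mult H u) + ∑ (deg H′))      ≡⟨ cong (λ d → deg H u + (d + ∑ (deg H′))) (deg≡∑ H u) ⟨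
  deg H u + (deg H u + ∑ (deg H′))           ≡⟨ +-assoc (deg H u) (deg H u) _ ⟨
  deg H u + deg H u + ∑ (deg H′)             ≡⟨ cong (λ d → deg H u + d + ∑ (deg H′)) (+-identityʳ (deg H u)) ⟨
  2 * deg H u + ∑ (deg H′)                   ∎
  where
  open ≤-Reasoning
  H′ = H ─ ⁅ u ⁆
  pointwise : ∀ a → zeroAt u (deg H) a ≤ mult H u a + deg H′ a
  pointwise a with a ≟ u
  ... | yes refl = ≤-trans (≤-reflexive (updateAt-updates u (deg H))) z≤n
  ... | no  a≢u  = ≤-reflexive (begin-equality
    zeroAt u (deg H) a                     ≡⟨ updateAt-minimal a u (deg H) a≢u ⟩
    deg H a                                ≡⟨ deg-─ H ⁅ u ⁆ (a≢u ∘ x∈⁅y⁆⇒x≡y u) ⟩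
    deg H′ a + ∑[ w ∈ ⁅ u ⁆ ] mult H a w   ≡⟨ cong (deg H′ a +_) (trans (∑∈-⁅⁆ (mult H a) u) (mult-sym H a u)) ⟩
    deg H′ a + mult H u a                  ≡⟨ +-comm (deg H′ a) (mult H u a) ⟩
    mult H u a + deg H′ a                  ∎)

-- Forests

IsPath : MultiGraph n → List (Fin n) → Set
IsPath H vs = Unique vs × Linked (Adj H) vs

module _ {H : MultiGraph n} (acyclic : Acyclic H) where

  acyclic⇒loopless : ∀ v → ¬ Adj H v v
  acyclic⇒loopless v v~v = acyclic (v ∷ [] , ([] ∷ []) , v~v)

  acyclic⇒simple : ∀ {u v} → u ≢ v → mult H u v ≤ 1
  acyclic⇒simple u≢v = ≤-pred (≰⇒> λ 2≤ → acyclic (_ ∷ _ ∷ [] , ((u≢v ∷ []) ∷ [] ∷ []) , 2≤))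

  back-edge⇒¬path : ∀ {h q u rest} → IsPath H (h ∷ q ∷ rest) → u ∈ₗ rest → ¬ Adj H h u
  back-edge⇒¬path {rest = x ∷ xs} (U , h~q ∷ q~x ∷ L) u∈ h~u =
    acyclic ( _ ∷ _ ∷ x ∷ truncate xs u∈
            , Unique-resp-⊆ (refl ∷ refl ∷ refl ∷ truncate-⊆ xs u∈) U
            , h~q ∷ q~x ∷ Linked-truncate xs u∈ L (Adj-sym H h~u))

  fresh-neighbour : ∀ {h q u rest} → IsPath H (h ∷ q ∷ rest) → Adj H h u → u ≢ q → All (u ≢_) (h ∷ q ∷ rest)
  fresh-neighbour {rest = rest} path h~u u≢q =
    u≢h ∷ u≢q ∷ ¬Any⇒All¬ rest (λ u∈ → back-edge⇒¬path path u∈ h~u)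
    where
    u≢h = λ u≡h → acyclic⇒loopless _ (subst (Adj H _) u≡h h~u)

  module _ (deg≥2 : ∀ v → 0 < deg H v → 1 < deg H v) where

    other-neighbour : ∀ {h q} → h ≢ q → Adj H h q → ∃ λ u → u ≢ q × Adj H h u
    other-neighbour {h} {q} h≢q h~q = ∑-positive-elsewhere (mult H h) q (begin-strict
      mult H h q    ≤⟨ acyclic⇒simple h≢q ⟩
      1             <⟨ deg≥2 h (≤-trans h~q (mult≤deg H h q)) ⟩
      deg H h       ≡⟨ deg≡∑ H h ⟩
      ∑ (mult H h)  ∎)
      where open ≤-Reasoning

    extend-path : ∀ {h q rest} → IsPath H (h ∷ q ∷ rest) → ∃ λ u → IsPath H (u ∷ h ∷ q ∷ rest)
    extend-path path@(U@((h≢q ∷ _) ∷ _) , L@(h~q ∷ _)) with u , u≢q , h~u ← other-neighbour h≢q h~q =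
      u , (fresh-neighbour path h~u u≢q ∷ U) , (Adj-sym H h~u ∷ L)

    -- Extending the path k more times would give more than n distinct vertices.
    ¬path : ∀ k {h q rest} → n ≤ k + List.length rest → ¬ IsPath H (h ∷ q ∷ rest)
    ¬path zero    n≤len (U , _) = 1+n≰n (≤-trans (n≤1+n _) (≤-trans (length-unique U) n≤len))
    ¬path (suc k) n≤len path with _ , path′ ← extend-path path =
      ¬path k (≤-trans n≤len (≤-reflexive (sym (+-suc k _)))) path′

    edgeless : ∀ v → deg H v ≡ 0
    edgeless v = n≤0⇒n≡0 (≮⇒≥ λ 0<deg → let w , v~w = ∃-neighbour H v 0<deg in
      ¬path n (m≤m+n n 0) (((w≢v v~w ∷ []) ∷ [] ∷ []) , Adj-sym H v~w ∷ [-]))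
      where
      w≢v : ∀ {w} → Adj H v w → w ≢ v
      w≢v v~w w≡v = acyclic⇒loopless v (subst (Adj H v) w≡v v~w)

forest-∑deg : ∀ {H : MultiGraph n} → Acyclic H → ∀ (c : Vector ℕ n) →
              (∀ v → 0 < deg H v → 0 < c v) → ∑ (deg H) ≤ 2 * ∑ c
forest-∑deg {n} acyclic c covers = go (∑ c) acyclic c covers ≤-refl
  where
  go : ∀ k {H : MultiGraph n} → Acyclic H → ∀ c → (∀ v → 0 < deg H v → 0 < c v) →
       ∑ c ≤ k → ∑ (deg H) ≤ 2 * ∑ c
  go k {H} acyclic c covers ∑c≤k with any? (λ u → 0 <? c u ×-dec deg H u ≤? 1) | k
  ... | no no-leaf | _ = subst (_≤ 2 * ∑ c) (sym ∑deg≡0) z≤n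
    where
    deg≥2 : ∀ v → 0 < deg H v → 1 < deg H v
    deg≥2 v 0<deg = ≰⇒> (λ deg≤1 → no-leaf (v , covers v 0<deg , deg≤1))
    ∑deg≡0 : ∑ (deg H) ≡ 0
    ∑deg≡0 = trans (sum-cong-≗ (edgeless acyclic deg≥2)) (sum-replicate-zero n)
  ... | yes (u , 0<cu , _) | zero = contradiction (≤-trans 0<cu (≤-trans (∑-≥-term c u) ∑c≤k)) λ ()
  ... | yes (u , 0<cu , deg≤1) | suc k = begin
    ∑ (deg H)                 ≤⟨ ∑deg-─⁅⁆ H u ⟩
    2 * deg H u + ∑ (deg H′)  ≤⟨ +-mono-≤ (*-monoʳ-≤ 2 deg≤1) (go k acyclic′ c′ covers′ ∑c′≤k) ⟩
    2 * 1 + 2 * ∑ c′          ≡⟨ *-distribˡ-+ 2 1 (∑ c′) ⟨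
    2 * (1 + ∑ c′)            ≤⟨ *-monoʳ-≤ 2 (+-monoˡ-≤ (∑ c′) 0<cu) ⟩
    2 * (c u + ∑ c′)          ≡⟨ cong (2 *_) (∑-zeroAt c u) ⟨
    2 * ∑ c                   ∎
    where
    open ≤-Reasoning
    H′ = H ─ ⁅ u ⁆
    c′ = zeroAt u c
    acyclic′ : Acyclic H′
    acyclic′ (vs , cycle) = acyclic (vs , cycle-mono (─-≤ H ⁅ u ⁆) cycle)
    covers′ : ∀ v → 0 < deg H′ v → 0 < c′ v
    covers′ v 0<deg′ with v ≟ u
    ... | yes refl = contradiction (deg-─-∈ H ⁅ u ⁆ (x∈⁅x⁆ u)) (>⇒≢ 0<deg′)
    ... | no  v≢u  = subst (0 <_) (sym (updateAt-minimal v u c v≢u))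
                           (covers v (≤-trans 0<deg′ (deg-─-≤ H ⁅ u ⁆ v)))
    ∑c′≤k : ∑ c′ ≤ k
    ∑c′≤k = ≤-pred (≤-trans (+-monoˡ-≤ (∑ c′) 0<cu) (subst (_≤ suc k) (∑-zeroAt c u) ∑c≤k))

-- Reduced multigraphs

deg≡2⇒neighbours⊆ : ∀ (G : MultiGraph n) {v a b} → deg G v ≡ 2 → a ≢ b → Adj G v a → Adj G v b →
                    ∀ w → Adj G v w → w ≡ a ⊎ w ≡ b
deg≡2⇒neighbours⊆ G {v} {a} {b} deg≡2 a≢b v~a v~b w v~w with w ≟ a | w ≟ b
... | yes w≡a | _       = inj₁ w≡a
... | no  _   | yes w≡b = inj₂ w≡b
... | no  w≢a | no  w≢b = contradiction (begin
  3                                       ≤⟨ +-mono-≤ v~a (+-mono-≤ v~b v~w) ⟩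
  mult G v a + (mult G v b + mult G v w)  ≤⟨ ∑-≥-three-terms (mult G v) a≢b (w≢a ∘ sym) (w≢b ∘ sym) ⟩
  ∑ (mult G v)                            ≡⟨ deg≡∑ G v ⟨
  deg G v                                 ≡⟨ deg≡2 ⟩
  2                                       ∎) 1+n≰n
  where open ≤-Reasoning

weight : ℕ → ℕ
weight 2 = 2
weight _ = 1

weight-≢2 : ∀ {d} → d ≢ 2 → weight d ≡ 1
weight-≢2 {0}                 _   = refl
weight-≢2 {1}                 _   = refl
weight-≢2 {2}                 d≢2 = contradiction refl d≢2
weight-≢2 {suc (suc (suc _))} _   = refl

weight≤2 : ∀ d → weight d ≤ 2
weight≤2 d with d ≟ℕ 2
... | yes refl = ≤-refl
... | no  d≢2  = ≤-trans (≤-reflexive (weight-≢2 d≢2)) (s≤s z≤n)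

weighted-split≥3 : ∀ d dH dX → d ≡ dH + dX → 2 ≤ d → (d ≡ 2 → 0 < dX) → 3 ≤ dH + weight d * dX
weighted-split≥3 0 _ _ _ () _
weighted-split≥3 1 _ _ _ (s≤s ()) _
weighted-split≥3 2 dH dX d≡ _ 0<dX = begin
  2 + 1           ≤⟨ +-mono-≤ (≤-reflexive d≡) (0<dX refl) ⟩
  dH + dX + dX    ≡⟨ +-assoc dH dX dX ⟩
  dH + (dX + dX)  ≡⟨ cong (λ t → dH + (dX + t)) (+-identityʳ dX) ⟨
  dH + 2 * dX     ∎
  where open ≤-Reasoning
weighted-split≥3 (suc (suc (suc d))) dH dX d≡ _ _ = begin
  3               ≤⟨ s≤s (s≤s (s≤s z≤n)) ⟩
  3 + d           ≡⟨ d≡ ⟩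
  dH + dX         ≡⟨ cong (dH +_) (*-identityˡ dX) ⟨
  dH + 1 * dX     ∎
  where open ≤-Reasoning

2*d≤3*d∸3 : ∀ {d} → 3 ≤ d → 2 * d ≤ 3 * d ∸ 3
2*d≤3*d∸3 {1}                 (s≤s ())
2*d≤3*d∸3 {2}                 (s≤s (s≤s ()))
2*d≤3*d∸3 {suc (suc (suc d))} _ = m≤n+m _ d

module Reduced {n} (G : MultiGraph n) (deg≥2 : ∀ v → 2 ≤ deg G v) (loopless : ∀ v → ¬ Adj G v v)
               (¬R2 : ¬ R2 G) (¬R3 : ¬ R3 G) (¬R4 : ¬ R4 G) where

  Adj⇒≢ : ∀ {v w} → Adj G v w → v ≢ w
  Adj⇒≢ {v} v~w refl = loopless v v~w

  deg≡2⇒mult≤1 : ∀ {v} → deg G v ≡ 2 → ∀ a → mult G v a ≤ 1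
  deg≡2⇒mult≤1 {v} deg≡2 a = ≤-pred (≤∧≢⇒< (subst (mult G v a ≤_) deg≡2 (mult≤deg G v a)) ¬double)
    where
    ¬double : mult G v a ≢ 2
    ¬double ≡2 with a ≟ v
    ... | yes refl = loopless v (subst (1 ≤_) (sym ≡2) (s≤s z≤n))
    ... | no  a≢v  = ¬R4 (a , v , a≢v , trans (mult-sym G a v) ≡2 , deg≡2)

  deg≡2⇒two-neighbours : ∀ {v} → deg G v ≡ 2 → ∃ λ a → ∃ λ b → a ≢ b × Adj G v a × Adj G v b
  deg≡2⇒two-neighbours {v} deg≡2 =
    let a , v~a       = ∃-neighbour G v (subst (0 <_) (sym deg≡2) z<s)
        b , b≢a , v~b = ∑-positive-elsewhere (mult G v) a (≤-<-trans (deg≡2⇒mult≤1 deg≡2 a) 1<∑)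
    in a , b , b≢a ∘ sym , v~a , v~b
    where
    1<∑ : 1 < ∑ (mult G v)
    1<∑ = subst (1 <_) (trans (sym deg≡2) (deg≡∑ G v)) ≤-refl

  triangle-deg≢2 : ∀ {v a b} → a ≢ b → Adj G v a → Adj G v b → Adj G a b →
                   (∀ w → Adj G v w → w ≡ a ⊎ w ≡ b) → deg G b ≢ 2
  triangle-deg≢2 {v} {a} {b} a≢b v~a v~b a~b N⊆ deg≡2 =
    ¬R3 (a , v , b , Adj⇒≢ v~a ∘ sym , a≢b , Adj⇒≢ v~b , Adj-sym G v~a , a~b , v~b , N[v] , N[b])
    where
    N[b]⊆ : ∀ w → Adj G b w → w ≡ v ⊎ w ≡ a
    N[b]⊆ = deg≡2⇒neighbours⊆ G deg≡2 (Adj⇒≢ v~a) (Adj-sym G v~b) (Adj-sym G a~b)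
    N[v] : ∀ w → (w ≡ v ⊎ Adj G v w) ⇔ (w ≡ a ⊎ w ≡ v ⊎ w ≡ b)
    N[v] w = mk⇔
      (λ { (inj₁ w≡v) → inj₂ (inj₁ w≡v) ; (inj₂ v~w) → [ inj₁ , inj₂ ∘ inj₂ ]′ (N⊆ w v~w) })
      (λ { (inj₁ refl) → inj₂ v~a ; (inj₂ (inj₁ w≡v)) → inj₁ w≡v ; (inj₂ (inj₂ refl)) → inj₂ v~b })
    N[b] : ∀ w → (w ≡ b ⊎ Adj G b w) ⇔ (w ≡ a ⊎ w ≡ v ⊎ w ≡ b)
    N[b] w = mk⇔
      (λ { (inj₁ w≡b) → inj₂ (inj₂ w≡b) ; (inj₂ b~w) → [ inj₂ ∘ inj₁ , inj₁ ]′ (N[b]⊆ w b~w) })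
      (λ { (inj₁ refl) → inj₂ (Adj-sym G a~b) ; (inj₂ (inj₁ refl)) → inj₂ (Adj-sym G v~b)
         ; (inj₂ (inj₂ w≡b)) → inj₁ w≡b })

  record DegreeTwoNeighbourhood (v : Fin n) : Set where
    field
      a b   : Fin n
      a≢b   : a ≢ b
      v~a   : Adj G v a
      v~b   : Adj G v b
      a~b   : Adj G a b
      N⊆    : ∀ w → Adj G v w → w ≡ a ⊎ w ≡ b
      deg-a : deg G a ≢ 2
      deg-b : deg G b ≢ 2

  degree-two : ∀ {v} → deg G v ≡ 2 → DegreeTwoNeighbourhood v
  degree-two {v} deg≡2 with a , b , a≢b , v~a , v~b ← deg≡2⇒two-neighbours deg≡2 = record
    { a = a ; b = b ; a≢b = a≢b ; v~a = v~a ; v~b = v~b ; a~b = a~b ; N⊆ = N⊆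
    ; deg-a = triangle-deg≢2 (a≢b ∘ sym) v~b v~a (Adj-sym G a~b) (Sum.swap ∘₂ N⊆)
    ; deg-b = triangle-deg≢2 a≢b v~a v~b a~b N⊆
    }
    where
    N⊆ = deg≡2⇒neighbours⊆ G deg≡2 a≢b v~a v~b
    a~b : Adj G a b
    a~b with 1 ≤? mult G a b
    ... | yes a~b = a~b
    ... | no ¬a~b = contradiction
      (a , v , b , Adj⇒≢ v~a ∘ sym , Adj⇒≢ v~b , a≢b , Adj-sym G v~a , v~b , n≤0⇒n≡0 (≮⇒≥ ¬a~b) ,
       λ w → mk⇔ (N⊆ w) [ (λ { refl → v~a }) , (λ { refl → v~b }) ]′) ¬R2

  neighbour-deg≢2 : ∀ w → ∃ λ z → Adj G w z × deg G z ≢ 2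
  neighbour-deg≢2 w with u , w~u ← ∃-neighbour G w (≤-trans (s≤s z≤n) (deg≥2 w)) | deg G u ≟ℕ 2
  ... | no  deg≢2 = u , w~u , deg≢2
  ... | yes deg≡2 = beyond (degree-two deg≡2) (Adj-sym G w~u)
    where
    beyond : ∀ {u} → DegreeTwoNeighbourhood u → Adj G u w → ∃ λ z → Adj G w z × deg G z ≢ 2
    beyond D u~w with DegreeTwoNeighbourhood.N⊆ D w u~w
    ... | inj₁ refl = _ , a~b , deg-b where open DegreeTwoNeighbourhood D
    ... | inj₂ refl = _ , Adj-sym G a~b , deg-a where open DegreeTwoNeighbourhood D

  maxDeg≥3 : Fin n → 3 ≤ maxDeg G
  maxDeg≥3 w with z , _ , deg≢2 ← neighbour-deg≢2 w =
    ≤-trans (≤∧≢⇒< (deg≥2 z) (deg≢2 ∘ sym)) (deg≤maxDeg G z)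

  weightedDeg : Fin n → ℕ
  weightedDeg w = ∑ (λ v → weight (deg G v) * mult G v w)

  weightedDeg<2*maxDeg : ∀ w → weightedDeg w < 2 * maxDeg G
  weightedDeg<2*maxDeg w with z , w~z , deg≢2 ← neighbour-deg≢2 w = begin-strict
    weightedDeg w             <⟨ ∑-mono-< (λ v → *-monoˡ-≤ (mult G v w) (weight≤2 (deg G v))) z at-z ⟩
    ∑ (λ v → 2 * mult G v w)  ≡⟨ *-distribˡ-sum 2 (λ v → mult G v w) ⟨
    2 * ∑ (λ v → mult G v w)  ≡⟨ cong (2 *_) (trans (sum-cong-≗ (λ v → mult-sym G v w)) (sym (deg≡∑ G w))) ⟩
    2 * deg G w               ≤⟨ *-monoʳ-≤ 2 (deg≤maxDeg G w) ⟩
    2 * maxDeg G              ∎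
    where
    open ≤-Reasoning
    m = mult G z w
    at-z : weight (deg G z) * m < 2 * m
    at-z = subst (_< 2 * m) (sym (trans (cong (_* m) (weight-≢2 deg≢2)) (*-identityˡ m)))
                 (m<m+n m (subst (0 <_) (sym (*-identityˡ m)) (Adj-sym G w~z)))

  module _ {X : Subset n} (fvs : IsFVS G X) where

    deg≡2⇒∑∈X>0 : ∀ {v} → v ∉ X → deg G v ≡ 2 → 0 < ∑[ w ∈ X ] mult G v w
    deg≡2⇒∑∈X>0 {v} v∉X deg≡2 = triangle-meets-X (degree-two deg≡2)
      where
      triangle-meets-X : DegreeTwoNeighbourhood v → 0 < ∑[ w ∈ X ] mult G v w
      triangle-meets-X record { a = a ; b = b ; a≢b = a≢b ; v~a = v~a ; v~b = v~b ; a~b = a~b }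
        with a ∈? X | b ∈? X
      ... | yes a∈X | _       = ≤-trans v~a (∑∈-≥-term (mult G v) a∈X)
      ... | no  _   | yes b∈X = ≤-trans v~b (∑∈-≥-term (mult G v) b∈X)
      ... | no  a∉X | no  b∉X = contradiction
        ( v ∷ a ∷ b ∷ []
        , (((Adj⇒≢ v~a ∷ Adj⇒≢ v~b ∷ []) ∷ (a≢b ∷ []) ∷ [] ∷ []) , v~a ∷ a~b ∷ Adj-sym G v~b ∷ [-])
        , v∉X ∷ a∉X ∷ b∉X ∷ [])
        fvs

    toX : Fin n → ℕ
    toX v = weight (deg G v) * ∑[ w ∈ X ] mult G v w

    charge : Fin n → ℕ
    charge v = deg (G ─ X) v + toX v

    charge≥3 : ∀ {v} → v ∉ X → 3 ≤ charge v
    charge≥3 {v} v∉X = weighted-split≥3 (deg G v) _ _ (deg-─ G X v∉X) (deg≥2 v) (deg≡2⇒∑∈X>0 v∉X)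

    ∑∈∁X-deg≤2∣∁X∣ : ∑∈ (∁ X) (deg (G ─ X)) ≤ 2 * ∣ ∁ X ∣
    ∑∈∁X-deg≤2∣∁X∣ = begin
      ∑∈ (∁ X) (deg (G ─ X))  ≤⟨ ∑∈≤∑ (∁ X) (deg (G ─ X)) ⟩
      ∑ (deg (G ─ X))         ≤⟨ forest-∑deg (IsFVS⇒Acyclic G X fvs) (restrict (∁ X) (const 1)) covers ⟩
      2 * ∑[ v ∈ ∁ X ] 1      ≡⟨ cong (2 *_) (trans (∑∈-const (∁ X) 1) (*-identityʳ ∣ ∁ X ∣)) ⟩
      2 * ∣ ∁ X ∣             ∎
      where
      open ≤-Reasoning
      covers : ∀ v → 0 < deg (G ─ X) v → 0 < restrict (∁ X) (const 1) v
      covers v 0<deg = ≤-reflexive (sym (restrict-∈ (x∉p⇒x∈∁p v∉X)))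
        where
        v∉X : v ∉ X
        v∉X v∈X = >⇒≢ 0<deg (deg-─-∈ G X v∈X)

    ∑∈∁X-toX≤∑weightedDeg : ∑∈ (∁ X) toX ≤ ∑[ w ∈ X ] weightedDeg w
    ∑∈∁X-toX≤∑weightedDeg = begin
      ∑∈ (∁ X) toX
        ≤⟨ ∑∈≤∑ (∁ X) toX ⟩
      ∑ toX
        ≡⟨ sum-cong-≗ (λ v → *-distribˡ-∑∈ X (weight (deg G v)) (mult G v)) ⟩
      ∑ (λ v → ∑[ w ∈ X ] (weight (deg G v) * mult G v w))
        ≡⟨ ∑-∑∈-comm X (λ v w → weight (deg G v) * mult G v w) ⟩
      ∑[ w ∈ X ] weightedDeg w
        ∎
      where open ≤-Reasoning

    ∣∁X∣≤∑weightedDeg : ∣ ∁ X ∣ ≤ ∑[ w ∈ X ] weightedDeg w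
    ∣∁X∣≤∑weightedDeg = +-cancelˡ-≤ (2 * ∣ ∁ X ∣) _ _ (begin
      2 * ∣ ∁ X ∣ + ∣ ∁ X ∣                   ≡⟨ 2m+m≡m*3 ∣ ∁ X ∣ ⟩
      ∣ ∁ X ∣ * 3                             ≡⟨ ∑∈-const (∁ X) 3 ⟨
      ∑[ v ∈ ∁ X ] 3                          ≤⟨ ∑∈-mono-≤ (∁ X) (λ v v∈∁X → charge≥3 (x∈∁p⇒x∉p v∈∁X)) ⟩
      ∑∈ (∁ X) charge                         ≡⟨ ∑∈-distrib-+ (∁ X) (deg (G ─ X)) toX ⟩
      ∑∈ (∁ X) (deg (G ─ X)) + ∑∈ (∁ X) toX   ≤⟨ +-mono-≤ ∑∈∁X-deg≤2∣∁X∣ ∑∈∁X-toX≤∑weightedDeg ⟩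
      2 * ∣ ∁ X ∣ + ∑[ w ∈ X ] weightedDeg w  ∎)
      where
      open ≤-Reasoning
      2m+m≡m*3 : ∀ m → 2 * m + m ≡ m * 3
      2m+m≡m*3 = solve-∀

    n≤∣X∣*2maxDeg : n ≤ ∣ X ∣ * (2 * maxDeg G)
    n≤∣X∣*2maxDeg = begin
      n                                        ≡⟨ m+[n∸m]≡n (∣p∣≤n X) ⟨
      ∣ X ∣ + (n ∸ ∣ X ∣)                      ≡⟨ cong (∣ X ∣ +_) (∣∁p∣≡n∸∣p∣ X) ⟨
      ∣ X ∣ + ∣ ∁ X ∣                          ≤⟨ +-monoʳ-≤ ∣ X ∣ ∣∁X∣≤∑weightedDeg ⟩
      ∣ X ∣ + ∑[ w ∈ X ] weightedDeg w         ≡⟨ cong (_+ ∑[ w ∈ X ] weightedDeg w) ∑[X]1≡∣X∣ ⟨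
      ∑[ w ∈ X ] 1 + ∑[ w ∈ X ] weightedDeg w  ≡⟨ ∑∈-distrib-+ X (const 1) weightedDeg ⟨
      ∑[ w ∈ X ] (1 + weightedDeg w)           ≤⟨ ∑∈-mono-≤ X (λ w _ → weightedDeg<2*maxDeg w) ⟩
      ∑[ w ∈ X ] (2 * maxDeg G)                ≡⟨ ∑∈-const X (2 * maxDeg G) ⟩
      ∣ X ∣ * (2 * maxDeg G)                   ∎
      where
      open ≤-Reasoning
      ∑[X]1≡∣X∣ : ∑[ w ∈ X ] 1 ≡ ∣ X ∣
      ∑[X]1≡∣X∣ = trans (∑∈-const X 1) (*-identityʳ ∣ X ∣)

lemma16 : (n : ℕ) (G : MultiGraph n) (k : ℤ)
    → ¬ R1a G → ¬ R1b G → ¬ R1c G k → ¬ R1d G k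
    → ¬ R2 G → ¬ R3 G → ¬ R4 G → ¬ R5 G
    → (X : Subset n) → IsFVS G X
    → n ≤ (3 * maxDeg G ∸ 3) * ∣ X ∣
lemma16 zero    _ _ _ _    _ _    _   _   _   _ _ _   = z≤n
lemma16 (suc n) G _ _ ¬R1b _ ¬R1d ¬R2 ¬R3 ¬R4 _ X fvs = begin
  suc n                       ≤⟨ n≤∣X∣*2maxDeg fvs ⟩
  ∣ X ∣ * (2 * maxDeg G)      ≡⟨ *-comm ∣ X ∣ (2 * maxDeg G) ⟩
  2 * maxDeg G * ∣ X ∣        ≤⟨ *-monoˡ-≤ ∣ X ∣ (2*d≤3*d∸3 (maxDeg≥3 zero)) ⟩
  (3 * maxDeg G ∸ 3) * ∣ X ∣  ∎
  where
  open ≤-Reasoning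
  deg≥2 : ∀ v → 2 ≤ deg G v
  deg≥2 v = ≰⇒> (λ deg≤1 → ¬R1b (v , deg≤1))
  loopless : ∀ v → ¬ Adj G v v
  loopless v loop = ¬R1d (v , inj₁ loop)
  open Reduced G deg≥2 loopless ¬R2 ¬R3 ¬R4
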